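{- Let $n\ge 1$, $1\le a\le n$, $b=n-a$. Let $\pi=(\pi(1),\dots,\pi(a))$ be a sequence of distinct elements of $[n]$ and $\theta$ an ordering of $[n]\setminus\{\pi(1),\dots,\pi(a)\}$. Let $\sigma$ be a shuffle of $\theta$ and $\pi$. For $i=1,\dots,a$ let $\sigma_i$ be the subword of $\sigma$ consisting of the letters of $\theta$ together with $\pi(i),\dots,\pi(a)$, and set $\sigma_{a+1}=\theta$; let $k_i$ be the position of $\pi(i)$ in $\sigma_i$ (so $\sigma_i$ is obtained by inserting $\pi(i)$ into $\sigma_{i+1}$ at position $k_i$). Let $S_i$ be the set of the first $k_i$ entries of $MIS(\sigma_{i+1},\pi(i))$ and $T_i=\{s-d_i(\pi): s\in S_i\}$. Then $T_1\subseteq T_2\subseteq\cdots\subseteq T_a\subseteq\{0,1,\dots,b\}$.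
   Context: For a word $w=w(1)\cdots w(m)$ of distinct integers, index $i\in\{1,\dots,m-1\}$ is a descent if $w(i)>w(i+1)$; $\mathrm{maj}(w)$ is the sum of the descents; $d_k(w)$ is the number of descents of $w$ that are $\ge k$. For a word $\sigma$ of length $m-1$ of distinct integers, an integer $r$ not in $\sigma$, and $k\in\{1,\dots,m\}$, let $\sigma_k^r$ be the word obtained by inserting $r$ so that it becomes the $k$-th letter; $mi(\sigma,k,r)=\mathrm{maj}(\sigma_k^r)-\mathrm{maj}(\sigma)$ and $MIS(\sigma,r)=(mi(\sigma,1,r),\dots,mi(\sigma,m,r))$. A shuffle of $\theta$ and $\pi$ is a word of length $n$ containing both as subwords. -}

module Defs where

open import Data.Nat using (ℕ; zero; suc; _∸_; _<ᵇ_; _≡ᵇ_; _≤?_; _<?_)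
open import Data.Bool using (if_then_else_)
open import Data.List using (List; []; _∷_; _++_; take; drop; filter; length; map; upTo)
open import Data.Nat.ListAction using (sum)
open import Data.List.Membership.DecPropositional (Data.Nat._≟_) using (_∈?_)
open import Data.Integer using (ℤ; +_; _-_)
open import Relation.Nullary.Decidable using (_⊎-dec_; does)

-- Words are lists of naturals; positions/indices are 1-based as in the paper.

descFrom : ℕ → List ℕ → List ℕ
descFrom i (x ∷ y ∷ w) =
  if y <ᵇ x then i ∷ descFrom (suc i) (y ∷ w) else descFrom (suc i) (y ∷ w)
descFrom i _ = []

descents : List ℕ → List ℕ
descents w = descFrom 1 w

maj : List ℕ → ℕ
maj w = sum (descents w)

dk : ℕ → List ℕ → ℕ
dk k w = length (filter (λ j → k ≤? j) (descents w))

insertAt : ℕ → ℕ → List ℕ → List ℕ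
insertAt k r w = take (k ∸ 1) w ++ r ∷ drop (k ∸ 1) w

mi : List ℕ → ℕ → ℕ → ℤ
mi σ k r = + maj (insertAt k r σ) - + maj σ

MIS : List ℕ → ℕ → List ℤ
MIS σ r = map (λ k → mi σ k r) (map suc (upTo (suc (length σ))))

-- w(i), 1-based (default 0 out of range)
nth : List ℕ → ℕ → ℕ
nth [] i = 0
nth (x ∷ w) zero = 0
nth (x ∷ w) (suc zero) = x
nth (x ∷ w) (suc (suc i)) = nth w (suc i)

pos : ℕ → List ℕ → ℕ
pos r [] = 0
pos r (x ∷ w) = if x ≡ᵇ r then 1 else suc (pos r w)

sigmaI : ℕ → List ℕ → List ℕ → List ℕ → ℕ → List ℕ
sigmaI a θ π σ i =
  if does (a <? i) then θ
  else filter (λ x → (x ∈? θ) ⊎-dec (x ∈? drop (i ∸ 1) π)) σ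

kI : ℕ → List ℕ → List ℕ → List ℕ → ℕ → ℕ
kI a θ π σ i = pos (nth π i) (sigmaI a θ π σ i)

SI : ℕ → List ℕ → List ℕ → List ℕ → ℕ → List ℤ
SI a θ π σ i = take (kI a θ π σ i) (MIS (sigmaI a θ π σ (suc i)) (nth π i))

TI : ℕ → List ℕ → List ℕ → List ℕ → ℕ → List ℤ
TI a θ π σ i = map (λ s → s - + dk i π) (SI a θ π σ i)

-- Let g(r, w) = maj(r w) - maj(w) = des(w) + [r > w(1)] be the front gain.
-- Moving an inserted letter r one place to the right past a letter x either
-- lowers the gain by one or produces a new maximum (insert-past), so the first
-- p + 1 entries of MIS(τ, r) are exactly the integers g(r, τ′), …, g(r, τ′) + p,
-- where τ′ is τ without its first p letters (misPrefix-range).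
--
-- Writing σ_i = A π(i) B we get σ_{i+1} = A B, k_i = |A| + 1, hence
-- S_i = [g(π(i), B), g(π(i), B) + |A|] (Shuffle.Stage).  From i to i + 1 we
-- have B = m π(i+1) B′ and A′ = A m; the sandwich bounds on g(π(i), m π(i+1) B′)
-- and d_i(π) = d_{i+1}(π) + [π(i+1) < π(i)] give T_i ⊆ T_{i+1} (T-step).
-- Finally d_a(π) = 0, g(r, B) ≤ |B| and |A| + |B| = |θ| ≤ n - a (T-last).
module Submission where

open import Defs
open import Data.Nat using (ℕ; _≤_; _<_; _∸_)
open import Data.Integer using (ℤ; +_)
open import Data.Integer as ℤ using ()
open import Data.Product using (_×_)
open import Data.List using (List; length)
open import Data.List.Membership.Propositional using (_∈_; _∉_)
open import Data.List.Relation.Unary.All using (All)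
open import Data.List.Relation.Unary.Unique.Propositional using (Unique)
open import Data.List.Relation.Binary.Sublist.Propositional using (_⊆_)
open import Data.List.Relation.Binary.Subset.Propositional as Sub using ()
open import Relation.Binary.PropositionalEquality using (_≡_)
open import Function.Bundles using (_⇔_)

open import Data.Nat using (zero; suc; _+_; _<ᵇ_; _≡ᵇ_; _≤?_; _<?_; _≟_; z≤n; s≤s)
open import Data.Nat.Properties
open import Data.Nat.ListAction using (sum)
open import Data.Nat.ListAction.Properties using (sum-++)
open import Data.Nat.Tactic.RingSolver using (solve-∀)
open import Data.Bool using (Bool; true; false; T; if_then_else_)
open import Data.Empty using (⊥; ⊥-elim)
open import Data.Unit using (tt)
open import Data.Sum using (_⊎_; inj₁; inj₂)
open import Data.Product using (Σ; _,_; proj₁; proj₂)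
open import Data.List using ([]; _∷_; _++_; [_]; take; drop; filter; map; upTo; applyUpTo)
import Data.List.Properties as Listₚ
open import Data.List.Relation.Unary.All using ([]; _∷_)
import Data.List.Relation.Unary.All as All
import Data.List.Relation.Unary.All.Properties as Allₚ
open import Data.List.Relation.Unary.Any using (here; there)
open import Data.List.Relation.Unary.AllPairs using ([]; _∷_)
open import Data.List.Membership.Propositional.Properties
  using (∈-++⁻; ∈-++⁺ˡ; ∈-++⁺ʳ; ∈-∃++; ∈-filter⁻; ∈-filter⁺; ∈-applyUpTo⁻; ∈-map⁻; ∈-map⁺)
open import Data.List.Membership.DecPropositional _≟_ using (_∈?_)
import Data.List.Relation.Unary.Unique.Propositional.Properties as Uniqueₚ
open import Data.List.Relation.Binary.Sublist.Heterogeneous using ([]; _∷_; _∷ʳ_)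
open import Data.List.Relation.Binary.Sublist.Heterogeneous.Properties using (length-mono-≤; toPointwise)
open import Data.List.Relation.Binary.Pointwise using (Pointwise-≡⇒≡)
import Data.Integer.Properties as ℤₚ
open import Relation.Binary.PropositionalEquality
  using (refl; sym; trans; cong; cong₂; subst; subst₂; _≢_; module ≡-Reasoning)
open import Relation.Nullary using (yes; no; ¬_; ¬?)
open import Relation.Nullary.Decidable using (dec-true; dec-false; _⊎-dec_)
open import Function.Bundles using (Equivalence)
open import Relation.Unary using (Decidable)

⟦_⟧ : Bool → ℕ
⟦ true ⟧ = 1
⟦ false ⟧ = 0

<ᵇ-true⇒< : ∀ m n → (m <ᵇ n) ≡ true → m < n
<ᵇ-true⇒< m n e = <ᵇ⇒< m n (subst T (sym e) tt)

<ᵇ-false⇒≥ : ∀ m n → (m <ᵇ n) ≡ false → n ≤ m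
<ᵇ-false⇒≥ m n e = ≮⇒≥ λ m<n → subst T e (<⇒<ᵇ m<n)

both-< : ∀ m n → (m <ᵇ n) ≡ true → (n <ᵇ m) ≡ true → ⊥
both-< m n m<n n<m = <-asym (<ᵇ-true⇒< m n m<n) (<ᵇ-true⇒< n m n<m)

neither-< : ∀ {m n} → m ≢ n → (m <ᵇ n) ≡ false → (n <ᵇ m) ≡ false → ⊥
neither-< {m} {n} m≢n m≮n n≮m = m≢n (≤-antisym (<ᵇ-false⇒≥ n m n≮m) (<ᵇ-false⇒≥ m n m≮n))

des : List ℕ → ℕ
des w = length (descents w)

descFrom-length : ∀ i j w → length (descFrom i w) ≡ length (descFrom j w)
descFrom-length i j [] = refl
descFrom-length i j (x ∷ []) = refl
descFrom-length i j (x ∷ y ∷ w) with descFrom-length (suc i) (suc j) (y ∷ w) | y <ᵇ x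
... | ih | true = cong suc ih
... | ih | false = ih

descFrom-sum-suc : ∀ i w → sum (descFrom (suc i) w) ≡ length (descFrom i w) + sum (descFrom i w)
descFrom-sum-suc i [] = refl
descFrom-sum-suc i (x ∷ []) = refl
descFrom-sum-suc i (x ∷ y ∷ w) with descFrom-sum-suc (suc i) (y ∷ w) | y <ᵇ x
... | ih | true = trans (cong (λ z → suc i + z) ih) (swap i (length (descFrom (suc i) (y ∷ w))) (sum (descFrom (suc i) (y ∷ w))))
  where
  swap : ∀ a b c → suc a + (b + c) ≡ suc b + (a + c)
  swap = solve-∀
... | ih | false = ih

descFrom-++ : ∀ i u x w → descFrom i (u ++ x ∷ w) ≡ descFrom i (u ++ [ x ]) ++ descFrom (i + length u) (x ∷ w)
descFrom-++ i [] x w rewrite +-identityʳ i = refl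
descFrom-++ i (z ∷ []) x w with x <ᵇ z
... | true rewrite +-comm i 1 = refl
... | false rewrite +-comm i 1 = refl
descFrom-++ i (z ∷ y ∷ u) x w with descFrom-++ (suc i) (y ∷ u) x w | y <ᵇ z
... | ih | true rewrite ih | +-suc i (length (y ∷ u)) = refl
... | ih | false rewrite ih | +-suc i (length (y ∷ u)) = refl

-- The front gain g(r, w) = maj(r w) - maj(w) (see maj-cons): the descents of w
-- all move one place right, and r creates a descent at 1 unless r < w(1).
frontGain : ℕ → List ℕ → ℕ
frontGain r [] = 0
frontGain r (h ∷ w) = des (h ∷ w) + (if r <ᵇ h then 0 else 1)

maj-cons : ∀ r w → All (_≢ r) w → maj (r ∷ w) ≡ maj w + frontGain r w
maj-cons r [] _ = refl
maj-cons r (y ∷ w) (y≢r ∷ _) with descFrom-sum-suc 1 (y ∷ w) | y <ᵇ r in e₁ | r <ᵇ y in e₂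
... | _ | true | true = ⊥-elim (both-< y r e₁ e₂)
... | _ | false | false = ⊥-elim (neither-< y≢r e₁ e₂)
... | shift | true | false rewrite shift = arith (des (y ∷ w)) (maj (y ∷ w))
  where
  arith : ∀ D S → 1 + (D + S) ≡ S + (D + 1)
  arith = solve-∀
... | shift | false | true rewrite shift = arith (des (y ∷ w)) (maj (y ∷ w))
  where
  arith : ∀ D S → D + S ≡ S + (D + 0)
  arith = solve-∀

-- How an entry of MIS changes when the inserted letter r moves one place to the
-- right, past a letter x standing at position j.  With g′ = g(r, x w) and
-- g = g(r, w), the new increment v is either g, and then g′ = g + 1, or a new
-- maximum g′ + j, and then g′ = g.
data Shift (g′ g v j : ℕ) : Set where
  lowers : g′ ≡ suc g → v ≡ g → Shift g′ g v j
  jumps  : g′ ≡ g → v ≡ g′ + j → Shift g′ g v j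

insert-past : ∀ j x r w → x ≢ r → All (_≢ r) w →
  Σ ℕ λ v → (sum (descFrom j (x ∷ r ∷ w)) ≡ sum (descFrom j (x ∷ w)) + v)
          × Shift (frontGain r (x ∷ w)) (frontGain r w) v j
insert-past j x r [] _ _ with r <ᵇ x
... | true = j , +-identityʳ j , jumps refl refl
... | false = 0 , refl , lowers refl refl
insert-past j x r (y ∷ w) x≢r (y≢r ∷ _)
  with descFrom-sum-suc (suc j) (y ∷ w) | descFrom-length 1 (suc j) (y ∷ w) | descFrom-length 2 (suc j) (y ∷ w)
     | y <ᵇ x in yx | r <ᵇ x in rx | y <ᵇ r in yr | r <ᵇ y in ry
... | _ | _ | _ | _ | _ | true | true = ⊥-elim (both-< y r yr ry)
... | _ | _ | _ | _ | _ | false | false = ⊥-elim (neither-< y≢r yr ry)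
... | _ | _ | _ | true | false | false | true =
  ⊥-elim (<-irrefl refl (<-trans (<ᵇ-true⇒< y x yx) (<-≤-trans (≤∧≢⇒< (<ᵇ-false⇒≥ r x rx) x≢r) (<ᵇ-false⇒≥ y r yr))))
... | _ | _ | _ | false | true | true | false =
  ⊥-elim (<-irrefl refl (<-≤-trans (<-trans (<ᵇ-true⇒< y r yr) (<ᵇ-true⇒< r x rx)) (<ᵇ-false⇒≥ y x yx)))
... | shift | len₁ | len₂ | true | true | true | false rewrite shift | len₁ | len₂ =
  suc j + D , arith₁ j D S , jumps (arith₂ D) (arith₃ j D)
  where
  D = length (descFrom (suc j) (y ∷ w))
  S = sum (descFrom (suc j) (y ∷ w))
  arith₁ : ∀ j D S → j + (suc j + (D + S)) ≡ j + S + (suc j + D)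
  arith₁ = solve-∀
  arith₂ : ∀ D → suc D + 0 ≡ D + 1
  arith₂ = solve-∀
  arith₃ : ∀ j D → suc j + D ≡ suc D + 0 + j
  arith₃ = solve-∀
... | shift | len₁ | len₂ | true | true | false | true rewrite shift | len₁ | len₂ =
  D , arith j D S , lowers refl (sym (+-identityʳ D))
  where
  D = length (descFrom (suc j) (y ∷ w))
  S = sum (descFrom (suc j) (y ∷ w))
  arith : ∀ j D S → j + (D + S) ≡ j + S + D
  arith = solve-∀
... | shift | len₁ | len₂ | true | false | true | false rewrite shift | len₁ | len₂ =
  suc D , arith j D S , lowers refl (+-comm 1 D)
  where
  D = length (descFrom (suc j) (y ∷ w))
  S = sum (descFrom (suc j) (y ∷ w))
  arith : ∀ j D S → suc j + (D + S) ≡ j + S + suc D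
  arith = solve-∀
... | shift | len₁ | len₂ | false | true | false | true rewrite shift | len₁ | len₂ =
  j + D , arith₁ j D S , jumps refl (arith₂ j D)
  where
  D = length (descFrom (suc j) (y ∷ w))
  S = sum (descFrom (suc j) (y ∷ w))
  arith₁ : ∀ j D S → j + (D + S) ≡ S + (j + D)
  arith₁ = solve-∀
  arith₂ : ∀ j D → j + D ≡ D + 0 + j
  arith₂ = solve-∀
... | shift | len₁ | len₂ | false | false | true | false rewrite shift | len₁ | len₂ =
  suc j + D , arith₁ j D S , jumps refl (arith₂ j D)
  where
  D = length (descFrom (suc j) (y ∷ w))
  S = sum (descFrom (suc j) (y ∷ w))
  arith₁ : ∀ j D S → suc j + (D + S) ≡ S + (suc j + D)
  arith₁ = solve-∀
  arith₂ : ∀ j D → suc j + D ≡ D + 1 + j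
  arith₂ = solve-∀
... | shift | len₁ | len₂ | false | false | false | true rewrite shift | len₁ | len₂ =
  D , +-comm D S , lowers (trans (+-comm D 1) (cong suc (sym (+-identityʳ D)))) (sym (+-identityʳ D))
  where
  D = length (descFrom (suc j) (y ∷ w))
  S = sum (descFrom (suc j) (y ∷ w))

maj-insert-past : ∀ u x r w → x ≢ r → All (_≢ r) w →
  Σ ℕ λ v → (maj ((u ++ [ x ]) ++ r ∷ w) ≡ maj (u ++ x ∷ w) + v)
          × Shift (frontGain r (x ∷ w)) (frontGain r w) v (suc (length u))
maj-insert-past u x r w x≢r w≢r with insert-past (suc (length u)) x r w x≢r w≢r
... | v , local , shift = v , global , shift
  where
  open ≡-Reasoning
  P = descFrom 1 (u ++ [ x ])
  global : maj ((u ++ [ x ]) ++ r ∷ w) ≡ maj (u ++ x ∷ w) + v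
  global = begin
    sum (descFrom 1 ((u ++ [ x ]) ++ r ∷ w))          ≡⟨ cong (λ z → sum (descFrom 1 z)) (Listₚ.++-assoc u [ x ] (r ∷ w)) ⟩
    sum (descFrom 1 (u ++ x ∷ r ∷ w))                 ≡⟨ cong sum (descFrom-++ 1 u x (r ∷ w)) ⟩
    sum (P ++ descFrom (suc (length u)) (x ∷ r ∷ w))  ≡⟨ sum-++ P _ ⟩
    sum P + sum (descFrom (suc (length u)) (x ∷ r ∷ w)) ≡⟨ cong (λ z → sum P + z) local ⟩
    sum P + (sum (descFrom (suc (length u)) (x ∷ w)) + v) ≡⟨ sym (+-assoc (sum P) _ v) ⟩
    sum P + sum (descFrom (suc (length u)) (x ∷ w)) + v ≡⟨ cong (_+ v) (sym (sum-++ P _)) ⟩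
    sum (P ++ descFrom (suc (length u)) (x ∷ w)) + v  ≡⟨ cong (λ z → sum z + v) (sym (descFrom-++ 1 u x w)) ⟩
    sum (descFrom 1 (u ++ x ∷ w)) + v                 ∎

InRange : ℕ → ℕ → ℤ → Set
InRange lo len t = Σ ℕ λ s → (t ≡ + s) × (lo ≤ s) × (s < lo + len)

IsRange : List ℤ → ℕ → ℕ → Set
IsRange L lo len = ∀ t → (t ∈ L → InRange lo len t) × (InRange lo len t → t ∈ L)

range-singleton : ∀ lo → IsRange [ + lo ] lo 1
range-singleton lo t = (λ { (here refl) → lo , refl , ≤-refl , lo<lo+1 })
                     , (λ { (s , refl , lo≤s , s<lo+1) → here (cong +_ (≤-antisym (≤-pred (subst (s <_) (+-comm lo 1) s<lo+1)) lo≤s)) })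
  where
  lo<lo+1 : lo < lo + 1
  lo<lo+1 = subst (lo <_) (+-comm 1 lo) ≤-refl

-- Appending the next MIS entry to a range of length p + 1: by the Shift
-- dichotomy the range is extended either downwards or upwards.
range-extend : ∀ L g′ g v p → IsRange L g′ (suc p) → Shift g′ g v (suc p) → IsRange (L ++ [ + v ]) g (suc (suc p))
range-extend L g′ g v p range (lowers refl refl) t = into , onto
  where
  into : t ∈ L ++ [ + g ] → InRange g (suc (suc p)) t
  into m with ∈-++⁻ L m
  ... | inj₂ (here refl) = g , refl , ≤-refl , m<m+n g (s≤s z≤n)
  ... | inj₁ m′ with proj₁ (range t) m′
  ...   | s , refl , lo≤s , s<hi = s , refl , ≤-trans (n≤1+n g) lo≤s , subst (s <_) (sym (+-suc g (suc p))) s<hi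
  onto : InRange g (suc (suc p)) t → t ∈ L ++ [ + g ]
  onto (s , e , g≤s , s<hi) with m≤n⇒m<n∨m≡n g≤s
  ... | inj₂ refl = ∈-++⁺ʳ L (here e)
  ... | inj₁ g<s = ∈-++⁺ˡ (proj₂ (range t) (s , e , g<s , subst (s <_) (+-suc g (suc p)) s<hi))
range-extend L g′ g v p range (jumps refl refl) t = into , onto
  where
  into : t ∈ L ++ [ + (g + suc p) ] → InRange g (suc (suc p)) t
  into m with ∈-++⁻ L m
  ... | inj₂ (here refl) = g + suc p , refl , m≤m+n g (suc p) , +-monoʳ-< g (n<1+n (suc p))
  ... | inj₁ m′ with proj₁ (range t) m′
  ...   | s , refl , g≤s , s<hi = s , refl , g≤s , <-trans s<hi (+-monoʳ-< g (n<1+n (suc p)))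
  onto : InRange g (suc (suc p)) t → t ∈ L ++ [ + (g + suc p) ]
  onto (s , e , g≤s , s<hi) with m≤n⇒m<n∨m≡n (≤-pred (subst (s <_) (+-suc g (suc p)) s<hi))
  ... | inj₂ refl = ∈-++⁺ʳ L (here e)
  ... | inj₁ s<top = ∈-++⁺ˡ (proj₂ (range t) (s , e , g≤s , s<top))

misPrefix : List ℕ → ℕ → ℕ → List ℤ
misPrefix τ r p = map (λ k → mi τ k r) (map suc (upTo p))

take-applyUpTo : ∀ {A : Set} (f : ℕ → A) m n → m ≤ n → take m (applyUpTo f n) ≡ applyUpTo f m
take-applyUpTo f zero n _ = refl
take-applyUpTo f (suc m) (suc n) (s≤s m≤n) = cong (f 0 ∷_) (take-applyUpTo (λ x → f (suc x)) m n m≤n)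

take-MIS : ∀ τ r p → p ≤ suc (length τ) → take p (MIS τ r) ≡ misPrefix τ r p
take-MIS τ r p p≤ = begin
  take p (map (λ k → mi τ k r) (map suc (upTo (suc (length τ)))))  ≡⟨ Listₚ.take-map p _ ⟩
  map (λ k → mi τ k r) (take p (map suc (upTo (suc (length τ)))))  ≡⟨ cong (map (λ k → mi τ k r)) (Listₚ.take-map p _) ⟩
  map (λ k → mi τ k r) (map suc (take p (upTo (suc (length τ)))))  ≡⟨ cong (λ z → map (λ k → mi τ k r) (map suc z)) (take-applyUpTo (λ x → x) p _ p≤) ⟩
  misPrefix τ r p                                                   ∎
  where open ≡-Reasoning

misPrefix-snoc : ∀ τ r p → misPrefix τ r (suc p) ≡ misPrefix τ r p ++ [ mi τ (suc p) r ]
misPrefix-snoc τ r p = begin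
  map (λ k → mi τ k r) (map suc (upTo (suc p)))        ≡⟨ cong (λ z → map (λ k → mi τ k r) (map suc z)) (sym (Listₚ.upTo-∷ʳ p)) ⟩
  map (λ k → mi τ k r) (map suc (upTo p ++ [ p ]))     ≡⟨ cong (map (λ k → mi τ k r)) (Listₚ.map-++ suc (upTo p) [ p ]) ⟩
  map (λ k → mi τ k r) (map suc (upTo p) ++ [ suc p ]) ≡⟨ Listₚ.map-++ (λ k → mi τ k r) (map suc (upTo p)) [ suc p ] ⟩
  misPrefix τ r p ++ [ mi τ (suc p) r ]                ∎
  where open ≡-Reasoning

[+m+n]-[+m]≡+n : ∀ m n → + (m + n) ℤ.- + m ≡ + n
[+m+n]-[+m]≡+n m n = trans (ℤₚ.[+m]-[+n]≡m⊖n (m + n) m) (trans (ℤₚ.≤-⊖ (m≤m+n m n)) (cong +_ (m+n∸m≡n m n)))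

split-after : ∀ (τ : List ℕ) p → p < length τ →
  Σ ℕ λ x → (drop p τ ≡ x ∷ drop (suc p) τ) × (take (suc p) τ ≡ take p τ ++ [ x ])
split-after (x ∷ τ) zero _ = x , refl , refl
split-after (y ∷ τ) (suc p) (s≤s p<) with split-after τ p p<
... | x , dropEq , takeEq = x , dropEq , cong (y ∷_) takeEq

misPrefix-range : ∀ τ r → All (_≢ r) τ → ∀ p → p ≤ length τ →
  IsRange (misPrefix τ r (suc p)) (frontGain r (drop p τ)) (suc p)
misPrefix-range τ r τ≢r zero _ =
  subst (λ z → IsRange [ z ] (frontGain r τ) 1) (sym firstEntry) (range-singleton (frontGain r τ))
  where
  firstEntry : mi τ 1 r ≡ + frontGain r τ
  firstEntry = trans (cong (λ z → + z ℤ.- + maj τ) (maj-cons r τ τ≢r)) ([+m+n]-[+m]≡+n (maj τ) (frontGain r τ))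
misPrefix-range τ r τ≢r (suc p) p< with split-after τ p p<
... | x , dropEq , takeEq =
  subst (λ L → IsRange L (frontGain r w) (suc (suc p))) (sym prefixEq)
        (range-extend (misPrefix τ r (suc p)) _ _ v p (misPrefix-range τ r τ≢r p (≤-trans (n≤1+n p) p<)) shift)
  where
  u = take p τ
  w = drop (suc p) τ
  xw≢r : All (_≢ r) (x ∷ w)
  xw≢r = subst (All (_≢ r)) dropEq (Allₚ.drop⁺ p τ≢r)
  step = maj-insert-past u x r w (All.head xw≢r) (All.tail xw≢r)
  v = proj₁ step
  τ≡uxw : τ ≡ u ++ x ∷ w
  τ≡uxw = trans (sym (Listₚ.take++drop≡id (suc p) τ)) (trans (cong (_++ w) takeEq) (Listₚ.++-assoc u [ x ] w))
  |u|≡p : length u ≡ p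
  |u|≡p = trans (Listₚ.length-take p τ) (m≤n⇒m⊓n≡m (≤-trans (n≤1+n p) p<))
  nextEntry : mi τ (suc (suc p)) r ≡ + v
  nextEntry = begin
    + maj (take (suc p) τ ++ r ∷ w) ℤ.- + maj τ ≡⟨ cong (λ z → + maj (z ++ r ∷ w) ℤ.- + maj τ) takeEq ⟩
    + maj ((u ++ [ x ]) ++ r ∷ w) ℤ.- + maj τ   ≡⟨ cong (λ z → + z ℤ.- + maj τ) (proj₁ (proj₂ step)) ⟩
    + (maj (u ++ x ∷ w) + v) ℤ.- + maj τ        ≡⟨ cong (λ z → + (maj z + v) ℤ.- + maj τ) (sym τ≡uxw) ⟩
    + (maj τ + v) ℤ.- + maj τ                   ≡⟨ [+m+n]-[+m]≡+n (maj τ) v ⟩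
    + v                                         ∎
    where open ≡-Reasoning
  shift : Shift (frontGain r (drop p τ)) (frontGain r w) v (suc p)
  shift = subst₂ (λ z j → Shift (frontGain r z) (frontGain r w) v j) (sym dropEq) (cong suc |u|≡p) (proj₂ (proj₂ step))
  prefixEq : misPrefix τ r (suc (suc p)) ≡ misPrefix τ r (suc p) ++ [ + v ]
  prefixEq = trans (misPrefix-snoc τ r (suc p)) (cong (λ z → misPrefix τ r (suc p) ++ [ z ]) nextEntry)

frontGain-cons : ∀ r q w → r ≢ q → All (_≢ q) w → frontGain r (q ∷ w) ≡ frontGain q w + ⟦ q <ᵇ r ⟧
frontGain-cons r q [] r≢q _ with r <ᵇ q in rq | q <ᵇ r in qr
... | true | true = ⊥-elim (both-< r q rq qr)
... | false | false = ⊥-elim (neither-< r≢q rq qr)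
... | true | false = refl
... | false | true = refl
frontGain-cons r q (h ∷ w) r≢q (h≢q ∷ _)
  with descFrom-length 2 1 (h ∷ w) | r <ᵇ q in rq | q <ᵇ r in qr | h <ᵇ q in hq | q <ᵇ h in qh
... | _ | true | true | _ | _ = ⊥-elim (both-< r q rq qr)
... | _ | false | false | _ | _ = ⊥-elim (neither-< r≢q rq qr)
... | _ | _ | _ | true | true = ⊥-elim (both-< h q hq qh)
... | _ | _ | _ | false | false = ⊥-elim (neither-< h≢q hq qh)
... | len | true | false | true | false rewrite len = arith (des (h ∷ w))
  where
  arith : ∀ D → suc D + 0 ≡ D + 1 + 0
  arith = solve-∀
... | len | true | false | false | true rewrite len = sym (+-identityʳ _)
... | len | false | true | true | false rewrite len = arith (des (h ∷ w))
  where
  arith : ∀ D → suc D + 1 ≡ D + 1 + 1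
  arith = solve-∀
... | len | false | true | false | true rewrite len = cong (_+ 1) (sym (+-identityʳ _))

frontGain-prepend : ∀ r y h z → h ≢ r →
  (frontGain r (h ∷ z) ≤ frontGain r (y ∷ h ∷ z)) × (frontGain r (y ∷ h ∷ z) ≤ suc (frontGain r (h ∷ z)))
frontGain-prepend r y h z h≢r with descFrom-length 2 1 (h ∷ z) | h <ᵇ y in hy | r <ᵇ y in ry | r <ᵇ h in rh
... | _ | false | true | false = ⊥-elim (<-irrefl refl (<-≤-trans (<ᵇ-true⇒< r y ry) (≤-trans (<ᵇ-false⇒≥ h y hy) (<ᵇ-false⇒≥ r h rh))))
... | _ | true | false | true = ⊥-elim (<-irrefl refl (<-trans (<ᵇ-true⇒< h y hy) (≤-<-trans (<ᵇ-false⇒≥ r y ry) (<ᵇ-true⇒< r h rh))))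
... | len | true | true | true rewrite len | +-identityʳ (des (h ∷ z)) = n≤1+n _ , ≤-refl
... | len | true | true | false rewrite len | +-identityʳ (des (h ∷ z)) | +-comm (des (h ∷ z)) 1 = ≤-refl , n≤1+n _
... | len | true | false | false rewrite len = n≤1+n _ , ≤-refl
... | len | false | true | true rewrite len = ≤-refl , n≤1+n _
... | len | false | false | true rewrite len | +-identityʳ (des (h ∷ z)) | +-comm (des (h ∷ z)) 1 = n≤1+n _ , ≤-refl
... | len | false | false | false rewrite len = ≤-refl , n≤1+n _

frontGain-sandwich : ∀ r q m w → r ≢ q → All (_≢ r) m → All (_≢ q) w →
  (frontGain q w + ⟦ q <ᵇ r ⟧ ≤ frontGain r (m ++ q ∷ w))
  × (frontGain r (m ++ q ∷ w) ≤ frontGain q w + ⟦ q <ᵇ r ⟧ + length m)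
frontGain-sandwich r q [] w r≢q _ w≢q rewrite frontGain-cons r q w r≢q w≢q = ≤-refl , ≤-reflexive (sym (+-identityʳ _))
frontGain-sandwich r q (y ∷ []) w r≢q _ w≢q
  with frontGain-sandwich r q [] w r≢q [] w≢q | frontGain-prepend r y q w (λ e → r≢q (sym e))
... | lo , hi | grow , grow≤1 = ≤-trans lo grow , ≤-trans (≤-trans grow≤1 (s≤s hi)) (≤-reflexive (sym (+-suc _ 0)))
frontGain-sandwich r q (y ∷ x ∷ m) w r≢q (_ ∷ x≢r ∷ m≢r) w≢q
  with frontGain-sandwich r q (x ∷ m) w r≢q (x≢r ∷ m≢r) w≢q | frontGain-prepend r y x (m ++ q ∷ w) x≢r
... | lo , hi | grow , grow≤1 = ≤-trans lo grow , ≤-trans (≤-trans grow≤1 (s≤s hi)) (≤-reflexive (sym (+-suc _ (length (x ∷ m)))))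

descFrom-length-≤ : ∀ i h z → length (descFrom i (h ∷ z)) ≤ length z
descFrom-length-≤ i h [] = z≤n
descFrom-length-≤ i h (y ∷ z) with y <ᵇ h
... | true = s≤s (descFrom-length-≤ (suc i) y z)
... | false = m≤n⇒m≤1+n (descFrom-length-≤ (suc i) y z)

frontGain-≤-length : ∀ r z → frontGain r z ≤ length z
frontGain-≤-length r [] = z≤n
frontGain-≤-length r (h ∷ z) with r <ᵇ h
... | true = ≤-trans (≤-reflexive (+-identityʳ _)) (m≤n⇒m≤1+n (descFrom-length-≤ 1 h z))
... | false = subst (_≤ suc (length z)) (+-comm 1 _) (s≤s (descFrom-length-≤ 1 h z))

atLeast : ℕ → List ℕ → ℕ
atLeast i L = length (filter (λ d → i ≤? d) L)

descentAt : ℕ → List ℕ → ℕ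
descentAt k [] = 0
descentAt k (x ∷ []) = 0
descentAt zero (x ∷ y ∷ w) = ⟦ y <ᵇ x ⟧
descentAt (suc k) (x ∷ y ∷ w) = descentAt k (y ∷ w)

descentAt-nth : ∀ k w → suc k < length w → descentAt k w ≡ ⟦ nth w (suc (suc k)) <ᵇ nth w (suc k) ⟧
descentAt-nth zero (x ∷ []) (s≤s ())
descentAt-nth zero (x ∷ y ∷ w) _ = refl
descentAt-nth (suc k) (x ∷ y ∷ w) (s≤s k<) = descentAt-nth k (y ∷ w) k<

descFrom-≥ : ∀ j w → All (j ≤_) (descFrom j w)
descFrom-≥ j [] = []
descFrom-≥ j (x ∷ []) = []
descFrom-≥ j (x ∷ y ∷ w) with descFrom-≥ (suc j) (y ∷ w) | y <ᵇ x
... | ih | true = ≤-refl ∷ All.map <⇒≤ ih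
... | ih | false = All.map <⇒≤ ih

descFrom-< : ∀ j w → All (λ d → suc d < j + length w) (descFrom j w)
descFrom-< j [] = []
descFrom-< j (x ∷ []) = []
descFrom-< j (x ∷ y ∷ w) with descFrom-< (suc j) (y ∷ w) | y <ᵇ x
... | ih | true = head< ∷ All.map (λ {d} → subst (suc d <_) (sym (+-suc j (length (y ∷ w))))) ih
  where
  head< : suc j < j + suc (suc (length w))
  head< rewrite +-suc j (suc (length w)) | +-suc j (length w) = s≤s (s≤s (m≤m+n j (length w)))
... | ih | false = All.map (λ {d} → subst (suc d <_) (sym (+-suc j (length (y ∷ w))))) ih

dk-length : ∀ w → dk (length w) w ≡ 0
dk-length w = cong length (Listₚ.filter-none (λ d → length w ≤? d)
  (All.map (λ d< w≤d → <-irrefl refl (≤-<-trans w≤d (≤-pred d<))) (descFrom-< 1 w)))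

atLeast-descFrom : ∀ k j w → atLeast (j + k) (descFrom j w) ≡ atLeast (suc (j + k)) (descFrom j w) + descentAt k w
atLeast-descFrom k j [] = refl
atLeast-descFrom k j (x ∷ []) = refl
atLeast-descFrom zero j (x ∷ y ∷ w) rewrite +-identityʳ j
  with Listₚ.filter-all (λ d → j ≤? d) (All.map <⇒≤ (descFrom-≥ (suc j) (y ∷ w)))
     | Listₚ.filter-all (λ d → suc j ≤? d) (descFrom-≥ (suc j) (y ∷ w)) | y <ᵇ x
... | keepAll | keepAll′ | true
  rewrite Listₚ.filter-accept (λ d → j ≤? d) {xs = descFrom (suc j) (y ∷ w)} (≤-refl {j})
        | Listₚ.filter-reject (λ d → suc j ≤? d) {xs = descFrom (suc j) (y ∷ w)} (<-irrefl {j} refl)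
        | keepAll | keepAll′ = +-comm 1 _
... | keepAll | keepAll′ | false rewrite keepAll | keepAll′ = sym (+-identityʳ _)
atLeast-descFrom (suc k) j (x ∷ y ∷ w) rewrite +-suc j k with atLeast-descFrom k (suc j) (y ∷ w) | y <ᵇ x
... | ih | false = ih
... | ih | true
  rewrite Listₚ.filter-reject (λ d → suc (j + k) ≤? d) {xs = descFrom (suc j) (y ∷ w)} (<⇒≱ (s≤s (m≤m+n j k)))
        | Listₚ.filter-reject (λ d → suc (suc (j + k)) ≤? d) {xs = descFrom (suc j) (y ∷ w)} (<⇒≱ (s≤s (m≤n⇒m≤1+n (m≤m+n j k))))
        = ih

dk-step : ∀ i w → 1 ≤ i → i < length w → dk i w ≡ dk (suc i) w + ⟦ nth w (suc i) <ᵇ nth w i ⟧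
dk-step (suc k) w _ k< = trans (atLeast-descFrom k 1 w) (cong (λ z → dk (suc (suc k)) w + z) (descentAt-nth k w k<))

module _ {A : Set} {P : A → Set} (P? : Decidable P) where

  ⊆-filter : ∀ {xs ys} → xs ⊆ ys → All P xs → xs ⊆ filter P? ys
  ⊆-filter [] _ = []
  ⊆-filter {ys = y ∷ ys} (.y ∷ʳ xs⊆ys) pxs with P? y
  ... | yes _ = y ∷ʳ ⊆-filter xs⊆ys pxs
  ... | no _ = ⊆-filter xs⊆ys pxs
  ⊆-filter {x ∷ xs} {.x ∷ ys} (refl ∷ xs⊆ys) (px ∷ pxs) rewrite Listₚ.filter-accept P? {xs = ys} px = refl ∷ ⊆-filter xs⊆ys pxs

  length-filter-split : ∀ xs → length (filter P? xs) + length (filter (λ x → ¬? (P? x)) xs) ≡ length xs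
  length-filter-split [] = refl
  length-filter-split (x ∷ xs) with P? x
  ... | yes _ = cong suc (length-filter-split xs)
  ... | no _ = trans (+-suc _ _) (cong suc (length-filter-split xs))

module _ {A : Set} {P Q : A → Set} (P? : Decidable P) (Q? : Decidable Q) where

  length-filter-mono : (∀ x → P x → Q x) → ∀ xs → length (filter P? xs) ≤ length (filter Q? xs)
  length-filter-mono P⇒Q [] = z≤n
  length-filter-mono P⇒Q (x ∷ xs) with P? x | Q? x
  ... | yes _ | yes _ = s≤s (length-filter-mono P⇒Q xs)
  ... | yes p | no ¬q = ⊥-elim (¬q (P⇒Q x p))
  ... | no _ | yes _ = m≤n⇒m≤1+n (length-filter-mono P⇒Q xs)
  ... | no _ | no _ = length-filter-mono P⇒Q xs

  filter-cong-on : ∀ xs → All (λ x → (P x → Q x) × (Q x → P x)) xs → filter P? xs ≡ filter Q? xs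
  filter-cong-on [] _ = refl
  filter-cong-on (x ∷ xs) ((P⇒Q , Q⇒P) ∷ agree) with P? x | Q? x
  ... | yes _ | yes _ = cong (x ∷_) (filter-cong-on xs agree)
  ... | yes p | no ¬q = ⊥-elim (¬q (P⇒Q p))
  ... | no ¬p | yes q = ⊥-elim (¬p (Q⇒P q))
  ... | no _ | no _ = filter-cong-on xs agree

⊆-length-≡ : ∀ {A : Set} {xs ys : List A} → xs ⊆ ys → length ys ≤ length xs → xs ≡ ys
⊆-length-≡ xs⊆ys ys≤xs =
  Pointwise-≡⇒≡ (toPointwise (≤-antisym (length-mono-≤ xs⊆ys) ys≤xs) xs⊆ys)

unique-length-≤ : ∀ {A : Set} (xs ys : List A) → Unique xs → (∀ {x} → x ∈ xs → x ∈ ys) → length xs ≤ length ys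
unique-length-≤ [] ys _ _ = z≤n
unique-length-≤ (x ∷ xs) ys (x∉xs ∷ uxs) xs⊆ys with ∈-∃++ (xs⊆ys (here refl))
... | ys₁ , ys₂ , refl =
  ≤-trans (s≤s (unique-length-≤ xs (ys₁ ++ ys₂) uxs xs⊆ys′)) (≤-reflexive (sym (Listₚ.length-++-sucʳ ys₁ x ys₂)))
  where
  xs⊆ys′ : ∀ {z} → z ∈ xs → z ∈ ys₁ ++ ys₂
  xs⊆ys′ z∈xs with ∈-++⁻ ys₁ (xs⊆ys (there z∈xs))
  ... | inj₁ z∈ys₁ = ∈-++⁺ˡ z∈ys₁
  ... | inj₂ (here refl) = ⊥-elim (All.lookup x∉xs z∈xs refl)
  ... | inj₂ (there z∈ys₂) = ∈-++⁺ʳ ys₁ z∈ys₂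

split-at-first : ∀ {r : ℕ} xs → r ∈ xs → Σ (List ℕ) λ α → Σ (List ℕ) λ β → (xs ≡ α ++ r ∷ β) × All (_≢ r) α
split-at-first {r} (x ∷ xs) r∈ with x ≟ r
... | yes refl = [] , xs , refl , []
... | no x≢r with r∈
...   | here r≡x = ⊥-elim (x≢r (sym r≡x))
...   | there r∈xs with split-at-first xs r∈xs
...     | α , β , eq , α≢r = x ∷ α , β , cong (x ∷_) eq , x≢r ∷ α≢r

split-unique : ∀ {A : Set} {r : A} (X X′ Y Y′ : List A) → All (_≢ r) X → All (_≢ r) X′ → X ++ r ∷ Y ≡ X′ ++ r ∷ Y′ → (X ≡ X′) × (Y ≡ Y′)
split-unique [] [] Y Y′ _ _ refl = refl , refl
split-unique [] (x′ ∷ X′) Y Y′ _ (x′≢r ∷ _) refl = ⊥-elim (x′≢r refl)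
split-unique (x ∷ X) [] Y Y′ (x≢r ∷ _) _ refl = ⊥-elim (x≢r refl)
split-unique (x ∷ X) (x′ ∷ X′) Y Y′ (_ ∷ X≢r) (_ ∷ X′≢r) eq with Listₚ.∷-injective eq
... | refl , eq′ with split-unique X X′ Y Y′ X≢r X′≢r eq′
...   | X≡X′ , Y≡Y′ = cong (x ∷_) X≡X′ , Y≡Y′

unique-middle : ∀ {A : Set} {r : A} (X Y : List A) → Unique (X ++ r ∷ Y) → All (_≢ r) X × All (_≢ r) Y
unique-middle [] Y (r∉Y ∷ _) = [] , All.map (λ r≢y y≡r → r≢y (sym y≡r)) r∉Y
unique-middle (x ∷ X) Y (x∉ ∷ u) with unique-middle X Y u
... | X≢r , Y≢r = All.head (Allₚ.++⁻ʳ X x∉) ∷ X≢r , Y≢r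

pos-split : ∀ {r : ℕ} A B → All (_≢ r) A → pos r (A ++ r ∷ B) ≡ suc (length A)
pos-split {r} [] B _ with r ≡ᵇ r | ≡⇒≡ᵇ r r refl
... | true | _ = refl
pos-split {r} (x ∷ A) B (x≢r ∷ A≢r) with x ≡ᵇ r in e
... | true = ⊥-elim (x≢r (≡ᵇ⇒≡ x r (subst T (sym e) tt)))
... | false = cong suc (pos-split A B A≢r)

split-in-right : ∀ {A : Set} {q : A} (xs ys A′ B′ : List A) → All (_≢ q) xs → xs ++ ys ≡ A′ ++ q ∷ B′ →
  Σ (List A) λ m → (A′ ≡ xs ++ m) × (ys ≡ m ++ q ∷ B′)
split-in-right [] ys A′ B′ _ eq = A′ , refl , eq
split-in-right (x ∷ xs) ys [] B′ (x≢q ∷ _) refl = ⊥-elim (x≢q refl)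
split-in-right (x ∷ xs) ys (x′ ∷ A′) B′ (_ ∷ xs≢q) eq with Listₚ.∷-injective eq
... | refl , eq′ with split-in-right xs ys A′ B′ xs≢q eq′
...   | m , A′≡ , ys≡ = m , cong (x ∷_) A′≡ , ys≡

drop-length-++ : ∀ {A : Set} (xs ys : List A) → drop (length xs) (xs ++ ys) ≡ ys
drop-length-++ [] ys = refl
drop-length-++ (x ∷ xs) ys = drop-length-++ xs ys

drop-nth : ∀ j (w : List ℕ) → j < length w → drop j w ≡ nth w (suc j) ∷ drop (suc j) w
drop-nth zero (x ∷ w) _ = refl
drop-nth (suc j) (x ∷ y ∷ w) (s≤s j<) = drop-nth j (y ∷ w) j<

∈-drop : ∀ {A : Set} {x : A} k (xs : List A) → x ∈ drop k xs → x ∈ xs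
∈-drop zero xs x∈ = x∈
∈-drop (suc k) (y ∷ xs) x∈ = there (∈-drop k xs x∈)

[+m+d]-[+n+d]≡[+m]-[+n] : ∀ m n d → + (m + d) ℤ.- + (n + d) ≡ + m ℤ.- + n
[+m+d]-[+n+d]≡[+m]-[+n] m n d = begin
  + (m + d) ℤ.- + (n + d) ≡⟨ ℤₚ.[+m]-[+n]≡m⊖n (m + d) (n + d) ⟩
  (m + d) ℤ.⊖ (n + d)     ≡⟨ cong₂ ℤ._⊖_ (+-comm m d) (+-comm n d) ⟩
  (d + m) ℤ.⊖ (d + n)     ≡⟨ ℤₚ.+-cancelˡ-⊖ d m n ⟩
  m ℤ.⊖ n                 ≡⟨ sym (ℤₚ.[+m]-[+n]≡m⊖n m n) ⟩
  + m ℤ.- + n             ∎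
  where open ≡-Reasoning

shift-range : ∀ {g ℓ g′ ℓ′ δ s} d → g′ + δ ≤ g → g + ℓ ≤ g′ + δ + ℓ′ → g ≤ s → s < g + suc ℓ →
  Σ ℕ λ s′ → (+ s ℤ.- + (d + δ) ≡ + s′ ℤ.- + d) × (g′ ≤ s′) × (s′ < g′ + suc ℓ′)
shift-range {g} {ℓ} {g′} {ℓ′} {δ} {s} d low high g≤s s< =
  s ∸ δ , value , m+n≤o⇒m≤o∸n g′ (≤-trans low g≤s) , upper
  where
  δ≤s : δ ≤ s
  δ≤s = ≤-trans (m≤n+m δ g′) (≤-trans low g≤s)
  value : + s ℤ.- + (d + δ) ≡ + (s ∸ δ) ℤ.- + d
  value = trans (cong (λ u → + u ℤ.- + (d + δ)) (sym (m∸n+n≡m δ≤s))) ([+m+d]-[+n+d]≡[+m]-[+n] (s ∸ δ) d δ)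
  s≤ : s ≤ g′ + ℓ′ + δ
  s≤ = ≤-trans (≤-pred (subst (s <_) (+-suc g ℓ) s<)) (≤-trans high (≤-reflexive (swap g′ δ ℓ′)))
    where
    swap : ∀ x y z → x + y + z ≡ x + z + y
    swap = solve-∀
  upper : s ∸ δ < g′ + suc ℓ′
  upper = subst (s ∸ δ <_) (sym (+-suc g′ ℓ′)) (s≤s (subst (s ∸ δ ≤_) (m+n∸n≡m (g′ + ℓ′) δ) (∸-monoˡ-≤ δ s≤)))

module Shuffle (n a : ℕ) (1≤a : 1 ≤ a) (π θ σ : List ℕ)
  (|π|≡a : length π ≡ a) (π-unique : Unique π)
  (θ-letters : ∀ x → (x ∈ θ) ⇔ ((1 ≤ x × x ≤ n) × x ∉ π))
  (|σ|≡n : length σ ≡ n) (π⊆σ : π ⊆ σ) (θ⊆σ : θ ⊆ σ) where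

  ∈θ⇒ : ∀ {x} → x ∈ θ → (1 ≤ x × x ≤ n) × x ∉ π
  ∈θ⇒ {x} = Equivalence.to (θ-letters x)

  ⇒∈θ : ∀ {x} → (1 ≤ x × x ≤ n) × x ∉ π → x ∈ θ
  ⇒∈θ {x} = Equivalence.from (θ-letters x)

  -- Counting the letters 1, …, n: at most a of them lie in π, the rest in θ.
  n≤a+|θ| : n ≤ a + length θ
  n≤a+|θ| = begin
    n                                                                              ≡⟨ sym (Listₚ.length-applyUpTo suc n) ⟩
    length letters                                                                 ≡⟨ sym (length-filter-split (_∈? π) letters) ⟩
    length (filter (_∈? π) letters) + length (filter (λ x → ¬? (x ∈? π)) letters) ≤⟨ +-mono-≤ inπ notInπ ⟩
    a + length θ                                                                   ∎
    where
    open ≤-Reasoning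
    letters = applyUpTo suc n
    unique : Unique letters
    unique = Uniqueₚ.applyUpTo⁺₁ suc n (λ i<j _ e → <⇒≢ i<j (suc-injective e))
    inπ : length (filter (_∈? π) letters) ≤ a
    inπ = ≤-trans (unique-length-≤ _ π (Uniqueₚ.filter⁺ (_∈? π) unique) (λ x∈ → proj₂ (∈-filter⁻ (_∈? π) {xs = letters} x∈)))
                  (≤-reflexive |π|≡a)
    notInπ : length (filter (λ x → ¬? (x ∈? π)) letters) ≤ length θ
    notInπ = unique-length-≤ _ θ (Uniqueₚ.filter⁺ (λ x → ¬? (x ∈? π)) unique) into
      where
      into : ∀ {x} → x ∈ filter (λ x → ¬? (x ∈? π)) letters → x ∈ θ
      into x∈ with ∈-filter⁻ (λ x → ¬? (x ∈? π)) {xs = letters} x∈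
      ... | x∈letters , x∉π with ∈-applyUpTo⁻ suc {n = n} x∈letters
      ...   | i , i<n , refl = ⇒∈θ ((s≤s z≤n , i<n) , x∉π)

  -- Hence σ consists of the letters of π and of θ, each exactly once.
  private
    σπ σθ : List ℕ
    σπ = filter (_∈? π) σ
    σθ = filter (λ x → ¬? (x ∈? π)) σ

    π⊆σπ : π ⊆ σπ
    π⊆σπ = ⊆-filter (_∈? π) π⊆σ (All.tabulate (λ x∈ → x∈))

    θ⊆σθ : θ ⊆ σθ
    θ⊆σθ = ⊆-filter (λ x → ¬? (x ∈? π)) θ⊆σ (All.tabulate (λ x∈ → proj₂ (∈θ⇒ x∈)))

    |σπ|+|σθ|≡n : length σπ + length σθ ≡ n
    |σπ|+|σθ|≡n = trans (length-filter-split (_∈? π) σ) |σ|≡n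

    a≤|σπ| : a ≤ length σπ
    a≤|σπ| = ≤-trans (≤-reflexive (sym |π|≡a)) (length-mono-≤ π⊆σπ)

    |θ|≤|σθ| : length θ ≤ length σθ
    |θ|≤|σθ| = length-mono-≤ θ⊆σθ

  π≡σπ : π ≡ filter (_∈? π) σ
  π≡σπ = ⊆-length-≡ π⊆σπ (≤-trans |σπ|≤a (≤-reflexive (sym |π|≡a)))
    where
    |σπ|≤a : length σπ ≤ a
    |σπ|≤a = +-cancelʳ-≤ (length θ) (length σπ) a
      (≤-trans (+-monoʳ-≤ (length σπ) |θ|≤|σθ|) (≤-trans (≤-reflexive |σπ|+|σθ|≡n) n≤a+|θ|))

  θ≡σθ : θ ≡ filter (_∈? θ) σ
  θ≡σθ = ⊆-length-≡ (⊆-filter (_∈? θ) θ⊆σ (All.tabulate (λ x∈ → x∈)))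
    (≤-trans (length-filter-mono (_∈? θ) (λ x → ¬? (x ∈? π)) (λ x x∈ → proj₂ (∈θ⇒ x∈)) σ) |σθ|≤|θ|)
    where
    |σθ|≤|θ| : length σθ ≤ length θ
    |σθ|≤|θ| = +-cancelˡ-≤ a (length σθ) (length θ)
      (≤-trans (+-monoˡ-≤ (length σθ) a≤|σπ|) (≤-trans (≤-reflexive |σπ|+|σθ|≡n) n≤a+|θ|))

  |θ|≤n∸a : length θ ≤ n ∸ a
  |θ|≤n∸a = subst (_≤ n ∸ a) (m+n∸m≡n a (length θ))
    (∸-monoˡ-≤ a (≤-trans (+-mono-≤ a≤|σπ| |θ|≤|σθ|) (≤-reflexive |σπ|+|σθ|≡n)))

  Keep : ℕ → List ℕ → List ℕ
  Keep k w = filter (λ x → (x ∈? θ) ⊎-dec (x ∈? drop k π)) w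

  σ-word : ℕ → List ℕ
  σ-word i = sigmaI a θ π σ i

  σ-word-≤ : ∀ i → i ≤ a → σ-word i ≡ Keep (i ∸ 1) σ
  σ-word-≤ i i≤a rewrite dec-false (a <? i) (≤⇒≯ i≤a) = refl

  σ-word-last : σ-word (suc a) ≡ θ
  σ-word-last rewrite dec-true (a <? suc a) ≤-refl = refl

  σ-word-suc : ∀ i → i ≤ a → σ-word (suc i) ≡ Keep i σ
  σ-word-suc i i≤a with m≤n⇒m<n∨m≡n i≤a
  ... | inj₁ i<a = σ-word-≤ (suc i) i<a
  ... | inj₂ refl = trans σ-word-last (trans θ≡σθ (filter-cong-on (_∈? θ) (λ x → (x ∈? θ) ⊎-dec (x ∈? drop i π)) σ
                          (All.tabulate (λ _ → inj₁ , onlyθ))))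
    where
    onlyθ : ∀ {x} → x ∈ θ ⊎ x ∈ drop i π → x ∈ θ
    onlyθ (inj₁ x∈θ) = x∈θ
    onlyθ (inj₂ x∈) rewrite Listₚ.drop-all i π (≤-reflexive |π|≡a) with x∈
    ... | ()

  π-at : ∀ i′ → suc i′ ≤ a → drop i′ π ≡ nth π (suc i′) ∷ drop (suc i′) π
  π-at i′ i<a = drop-nth i′ π (≤-trans i<a (≤-reflexive (sym |π|≡a)))

  π-split : ∀ i′ → suc i′ ≤ a → π ≡ take i′ π ++ nth π (suc i′) ∷ drop (suc i′) π
  π-split i′ i<a = trans (sym (Listₚ.take++drop≡id i′ π)) (cong (take i′ π ++_) (π-at i′ i<a))

  nth-∈ : ∀ i′ → suc i′ ≤ a → nth π (suc i′) ∈ π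
  nth-∈ i′ i<a = ∈-drop i′ π (subst (nth π (suc i′) ∈_) (sym (π-at i′ i<a)) (here refl))

  Keep-agrees : ∀ i′ → suc i′ ≤ a → (w : List ℕ) → All (_≢ nth π (suc i′)) w → Keep i′ w ≡ Keep (suc i′) w
  Keep-agrees i′ i<a w w≢r = filter-cong-on (λ x → (x ∈? θ) ⊎-dec (x ∈? drop i′ π)) (λ x → (x ∈? θ) ⊎-dec (x ∈? drop (suc i′) π)) w
    (All.map (λ x≢r → later x≢r , earlier) w≢r)
    where
    later : ∀ {x} → x ≢ nth π (suc i′) → x ∈ θ ⊎ x ∈ drop i′ π → x ∈ θ ⊎ x ∈ drop (suc i′) π
    later _ (inj₁ x∈θ) = inj₁ x∈θ
    later {x} x≢r (inj₂ x∈) = past-r (subst (x ∈_) (π-at i′ i<a) x∈)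
      where
      past-r : x ∈ nth π (suc i′) ∷ drop (suc i′) π → x ∈ θ ⊎ x ∈ drop (suc i′) π
      past-r (here x≡r) = ⊥-elim (x≢r x≡r)
      past-r (there x∈′) = inj₂ x∈′
    earlier : ∀ {x} → x ∈ θ ⊎ x ∈ drop (suc i′) π → x ∈ θ ⊎ x ∈ drop i′ π
    earlier (inj₁ x∈θ) = inj₁ x∈θ
    earlier {x} (inj₂ x∈) = inj₂ (subst (x ∈_) (sym (π-at i′ i<a)) (there x∈))

  π-dropped : ∀ i′ → suc i′ ≤ a → ¬ (nth π (suc i′) ∈ θ ⊎ nth π (suc i′) ∈ drop (suc i′) π)
  π-dropped i′ i<a (inj₁ r∈θ) = proj₂ (∈θ⇒ r∈θ) (nth-∈ i′ i<a)
  π-dropped i′ i<a (inj₂ r∈) =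
    All.lookup (proj₂ (unique-middle (take i′ π) (drop (suc i′) π) (subst Unique (π-split i′ i<a) π-unique))) r∈ refl

  next-letter-new : ∀ i′ → suc (suc i′) ≤ a →
    (nth π (suc i′) ≢ nth π (suc (suc i′))) × All (_≢ nth π (suc (suc i′))) (take i′ π)
  next-letter-new i′ i<a = All.head (Allₚ.++⁻ʳ (take i′ π) before) , Allₚ.++⁻ˡ (take i′ π) before
    where
    r = nth π (suc i′)
    π≡ : π ≡ (take i′ π ++ [ r ]) ++ nth π (suc (suc i′)) ∷ drop (suc (suc i′)) π
    π≡ = trans (π-split i′ (≤-trans (n≤1+n _) i<a))
           (trans (cong (λ z → take i′ π ++ r ∷ z) (π-at (suc i′) i<a)) (sym (Listₚ.++-assoc (take i′ π) [ r ] _)))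
    before = proj₁ (unique-middle (take i′ π ++ [ r ]) (drop (suc (suc i′)) π) (subst Unique π≡ π-unique))

  record Location (i′ : ℕ) : Set where
    field
      α β : List ℕ
      σ≡ : σ ≡ α ++ nth π (suc i′) ∷ β
      α≢r : All (_≢ nth π (suc i′)) α
      β≢r : All (_≢ nth π (suc i′)) β
      α-π-letters : filter (_∈? π) α ≡ take i′ π

  locate : ∀ i′ → suc i′ ≤ a → Location i′
  locate i′ i<a = record { α = α ; β = β ; σ≡ = σ≡ ; α≢r = α≢r ; β≢r = β≢r ; α-π-letters = proj₁ halves }
    where
    r = nth π (suc i′)
    r∈π = nth-∈ i′ i<a
    r-alone = unique-middle (take i′ π) (drop (suc i′) π) (subst Unique (π-split i′ i<a) π-unique)
    r∈σ : r ∈ σ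
    r∈σ = proj₁ (∈-filter⁻ (_∈? π) {xs = σ} (subst (r ∈_) π≡σπ r∈π))
    cut = split-at-first σ r∈σ
    α = proj₁ cut
    β = proj₁ (proj₂ cut)
    σ≡ : σ ≡ α ++ r ∷ β
    σ≡ = proj₁ (proj₂ (proj₂ cut))
    α≢r : All (_≢ r) α
    α≢r = proj₂ (proj₂ (proj₂ cut))
    πσ-split : filter (_∈? π) σ ≡ filter (_∈? π) α ++ r ∷ filter (_∈? π) β
    πσ-split = trans (cong (filter (_∈? π)) σ≡)
      (trans (Listₚ.filter-++ (_∈? π) α (r ∷ β)) (cong (filter (_∈? π) α ++_) (Listₚ.filter-accept (_∈? π) r∈π)))
    halves = split-unique (filter (_∈? π) α) (take i′ π) (filter (_∈? π) β) (drop (suc i′) π)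
      (Allₚ.filter⁺ (_∈? π) α≢r) (proj₁ r-alone) (trans (sym πσ-split) (trans (sym π≡σπ) (π-split i′ i<a)))
    β≢r : All (_≢ r) β
    β≢r = All.tabulate λ {x} x∈β x≡r →
      All.lookup (proj₂ r-alone) (subst (r ∈_) (proj₂ halves) (∈-filter⁺ (_∈? π) (subst (_∈ β) x≡r x∈β) r∈π)) refl

  record Cut (i′ : ℕ) : Set where
    field
      A B : List ℕ
      σ-at : σ-word (suc i′) ≡ A ++ nth π (suc i′) ∷ B
      σ-next : σ-word (suc (suc i′)) ≡ A ++ B
      k≡ : kI a θ π σ (suc i′) ≡ suc (length A)
      AB≢r : All (_≢ nth π (suc i′)) (A ++ B)
      A-π-letters : ∀ {q} → q ∈ π → All (_≢ q) (take i′ π) → All (_≢ q) A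

  build-cut : ∀ i′ → suc i′ ≤ a → Cut i′
  build-cut i′ i<a = record
    { A = Keep (suc i′) α ; B = Keep (suc i′) β ; σ-at = σ-at ; σ-next = σ-next
    ; k≡ = trans (cong (pos r) σ-at) (pos-split (Keep (suc i′) α) (Keep (suc i′) β) (Allₚ.filter⁺ _ α≢r))
    ; AB≢r = Allₚ.++⁺ (Allₚ.filter⁺ _ α≢r) (Allₚ.filter⁺ _ β≢r)
    ; A-π-letters = λ q∈π q∉prefix → Allₚ.filter⁺ _ (not-in-α q∈π q∉prefix) }
    where
    open Location (locate i′ i<a)
    r = nth π (suc i′)
    r-kept : r ∈ θ ⊎ r ∈ drop i′ π
    r-kept = inj₂ (subst (r ∈_) (sym (π-at i′ i<a)) (here refl))
    σ-at : σ-word (suc i′) ≡ Keep (suc i′) α ++ r ∷ Keep (suc i′) β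
    σ-at = begin
      σ-word (suc i′)                             ≡⟨ σ-word-≤ (suc i′) i<a ⟩
      Keep i′ σ                                   ≡⟨ cong (Keep i′) σ≡ ⟩
      Keep i′ (α ++ r ∷ β)                        ≡⟨ Listₚ.filter-++ _ α (r ∷ β) ⟩
      Keep i′ α ++ Keep i′ (r ∷ β)                ≡⟨ cong (Keep i′ α ++_) (Listₚ.filter-accept (λ x → (x ∈? θ) ⊎-dec (x ∈? drop i′ π)) r-kept) ⟩
      Keep i′ α ++ r ∷ Keep i′ β                  ≡⟨ cong₂ (λ u v → u ++ r ∷ v) (Keep-agrees i′ i<a α α≢r) (Keep-agrees i′ i<a β β≢r) ⟩
      Keep (suc i′) α ++ r ∷ Keep (suc i′) β      ∎
      where open ≡-Reasoning
    σ-next : σ-word (suc (suc i′)) ≡ Keep (suc i′) α ++ Keep (suc i′) β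
    σ-next = begin
      σ-word (suc (suc i′))                       ≡⟨ σ-word-suc (suc i′) i<a ⟩
      Keep (suc i′) σ                             ≡⟨ cong (Keep (suc i′)) σ≡ ⟩
      Keep (suc i′) (α ++ r ∷ β)                  ≡⟨ Listₚ.filter-++ _ α (r ∷ β) ⟩
      Keep (suc i′) α ++ Keep (suc i′) (r ∷ β)    ≡⟨ cong (Keep (suc i′) α ++_) (Listₚ.filter-reject (λ x → (x ∈? θ) ⊎-dec (x ∈? drop (suc i′) π)) (π-dropped i′ i<a)) ⟩
      Keep (suc i′) α ++ Keep (suc i′) β          ∎
      where open ≡-Reasoning
    not-in-α : ∀ {q} → q ∈ π → All (_≢ q) (take i′ π) → All (_≢ q) α
    not-in-α {q} q∈π q∉prefix = All.tabulate λ {x} x∈α x≡q →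
      All.lookup q∉prefix (subst (q ∈_) α-π-letters (∈-filter⁺ (_∈? π) (subst (_∈ α) x≡q x∈α) q∈π)) refl


  -- An opaque copy of build-cut: later stages only use the fields of a Cut,
  -- and hiding its proof terms keeps their type checking fast.
  abstract
    cut : ∀ i′ → suc i′ ≤ a → Cut i′
    cut = build-cut

  module Stage (i′ : ℕ) (i≤a : suc i′ ≤ a) where
    open Cut (cut i′ i≤a) public

    r : ℕ
    r = nth π (suc i′)

    S-range : IsRange (SI a θ π σ (suc i′)) (frontGain r B) (suc (length A))
    S-range = subst₂ (λ L z → IsRange L (frontGain r z) (suc (length A))) (sym S≡) (drop-length-++ A B)
      (misPrefix-range (A ++ B) r AB≢r (length A) (Listₚ.length-++-≤ˡ A))
      where
      S≡ : SI a θ π σ (suc i′) ≡ misPrefix (A ++ B) r (suc (length A))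
      S≡ = trans (cong₂ (λ k L → take k (MIS L r)) k≡ σ-next) (take-MIS (A ++ B) r (suc (length A)) (s≤s (Listₚ.length-++-≤ˡ A)))

    InT : ℤ → Set
    InT t = Σ ℕ λ s → (t ≡ + s ℤ.- + dk (suc i′) π) × (frontGain r B ≤ s) × (s < frontGain r B + suc (length A))

    T-member : ∀ t → t ∈ TI a θ π σ (suc i′) → InT t
    T-member t t∈ with ∈-map⁻ (λ s → s ℤ.- + dk (suc i′) π) t∈
    ... | s₀ , s₀∈ , refl with proj₁ (S-range s₀) s₀∈
    ...   | s , refl , g≤s , s< = s , refl , g≤s , s<

    T-complete : ∀ s → frontGain r B ≤ s → s < frontGain r B + suc (length A) → + s ℤ.- + dk (suc i′) π ∈ TI a θ π σ (suc i′)
    T-complete s g≤s s< = ∈-map⁺ (λ s → s ℤ.- + dk (suc i′) π) (proj₂ (S-range (+ s)) (s , refl , g≤s , s<))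

  T-step : ∀ i′ → suc (suc i′) ≤ a → TI a θ π σ (suc i′) Sub.⊆ TI a θ π σ (suc (suc i′))
  T-step i′ i<a {t} t∈ = transport (C.T-member t t∈)
    where
    module C = Stage i′ (≤-trans (n≤1+n _) i<a)
    module C′ = Stage (suc i′) i<a
    r = C.r
    q = C′.r
    new = next-letter-new i′ i<a
    -- σ_{i+1} = A B = A′ q B′ with q not in A, so B = m q B′ and A′ = A m.
    split = split-in-right C.A C.B C′.A C′.B
      (C.A-π-letters (nth-∈ (suc i′) i<a) (proj₂ new)) (trans (sym C.σ-next) C′.σ-at)
    m = proj₁ split
    A′≡ : C′.A ≡ C.A ++ m
    A′≡ = proj₁ (proj₂ split)
    B≡ : C.B ≡ m ++ q ∷ C′.B
    B≡ = proj₂ (proj₂ split)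
    δ = ⟦ q <ᵇ r ⟧
    bounds = frontGain-sandwich r q m C′.B (proj₁ new)
      (Allₚ.++⁻ˡ m (subst (All (_≢ r)) B≡ (Allₚ.++⁻ʳ C.A C.AB≢r))) (Allₚ.++⁻ʳ C′.A C′.AB≢r)
    low : frontGain q C′.B + δ ≤ frontGain r C.B
    low = subst (λ z → frontGain q C′.B + δ ≤ frontGain r z) (sym B≡) (proj₁ bounds)
    high : frontGain r C.B + length C.A ≤ frontGain q C′.B + δ + length C′.A
    high = begin
      frontGain r C.B + length C.A                     ≤⟨ +-monoˡ-≤ (length C.A) (subst (λ z → frontGain r z ≤ frontGain q C′.B + δ + length m) (sym B≡) (proj₂ bounds)) ⟩
      frontGain q C′.B + δ + length m + length C.A     ≡⟨ +-assoc (frontGain q C′.B + δ) (length m) (length C.A) ⟩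
      frontGain q C′.B + δ + (length m + length C.A)   ≡⟨ cong (λ z → frontGain q C′.B + δ + z) (trans (+-comm (length m) (length C.A)) (sym (Listₚ.length-++ C.A))) ⟩
      frontGain q C′.B + δ + length (C.A ++ m)         ≡⟨ cong (λ z → frontGain q C′.B + δ + length z) (sym A′≡) ⟩
      frontGain q C′.B + δ + length C′.A               ∎
      where open ≤-Reasoning
    d≡ : dk (suc i′) π ≡ dk (suc (suc i′)) π + δ
    d≡ = dk-step (suc i′) π (s≤s z≤n) (≤-trans i<a (≤-reflexive (sym |π|≡a)))
    transport : C.InT t → t ∈ TI a θ π σ (suc (suc i′))
    transport (s , t≡ , g≤s , s<) with shift-range (dk (suc (suc i′)) π) low high g≤s s<
    ... | s′ , value , g′≤s′ , s′< =
      subst (_∈ TI a θ π σ (suc (suc i′))) (sym (trans t≡ (trans (cong (λ d → + s ℤ.- + d) d≡) value))) (C′.T-complete s′ g′≤s′ s′<)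

  T-last : ∀ t → t ∈ TI a θ π σ a → + 0 ℤ.≤ t × t ℤ.≤ + (n ∸ a)
  T-last t t∈ = bound (C.T-member t (subst (λ i → t ∈ TI a θ π σ i) (sym a≡) t∈))
    where
    i′ = a ∸ 1
    a≡ : suc i′ ≡ a
    a≡ = trans (+-comm 1 i′) (m∸n+n≡m 1≤a)
    module C = Stage i′ (≤-reflexive a≡)
    d≡0 : dk (suc i′) π ≡ 0
    d≡0 = trans (cong (λ i → dk i π) (trans a≡ (sym |π|≡a))) (dk-length π)
    θ≡AB : θ ≡ C.A ++ C.B
    θ≡AB = trans (sym σ-word-last) (trans (cong (λ i → σ-word (suc i)) (sym a≡)) C.σ-next)
    s≤n∸a : ∀ s → s < frontGain C.r C.B + suc (length C.A) → s ≤ n ∸ a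
    s≤n∸a s s< = ≤-trans (≤-pred (begin-strict
      s                                   <⟨ s< ⟩
      frontGain C.r C.B + suc (length C.A) ≤⟨ +-monoˡ-≤ (suc (length C.A)) (frontGain-≤-length C.r C.B) ⟩
      length C.B + suc (length C.A)       ≡⟨ +-suc (length C.B) (length C.A) ⟩
      suc (length C.B + length C.A)       ≡⟨ cong suc (trans (+-comm (length C.B) (length C.A)) (sym (Listₚ.length-++ C.A))) ⟩
      suc (length (C.A ++ C.B))           ≡⟨ cong (λ w → suc (length w)) (sym θ≡AB) ⟩
      suc (length θ)                      ∎)) |θ|≤n∸a
      where open ≤-Reasoning
    bound : C.InT t → + 0 ℤ.≤ t × t ℤ.≤ + (n ∸ a)
    bound (s , t≡ , _ , s<) = subst (λ z → + 0 ℤ.≤ z × z ℤ.≤ + (n ∸ a)) (sym t≡s) (ℤ.+≤+ z≤n , ℤ.+≤+ (s≤n∸a s s<))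
      where
      t≡s : t ≡ + s
      t≡s = trans t≡ (trans (cong (λ d → + s ℤ.- + d) d≡0) (ℤₚ.+-identityʳ (+ s)))

-- Both parts are T-step and T-last of the shuffle analysis.
proposition4p1 : (n a : ℕ) → 1 ≤ n → 1 ≤ a → a ≤ n →
    (π θ σ : List ℕ) →
    length π ≡ a → Unique π → All (λ x → 1 ≤ x × x ≤ n) π →
    Unique θ → (∀ x → (x ∈ θ) ⇔ ((1 ≤ x × x ≤ n) × x ∉ π)) →
    length σ ≡ n → π ⊆ σ → θ ⊆ σ →
    ((i : ℕ) → 1 ≤ i → i < a → TI a θ π σ i Sub.⊆ TI a θ π σ (Data.Nat.suc i))
    × (∀ t → t ∈ TI a θ π σ a → (+ 0 ℤ.≤ t × t ℤ.≤ + (n ∸ a)))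
proposition4p1 n a _ 1≤a _ π θ σ |π|≡a π-unique _ _ θ-letters |σ|≡n π⊆σ θ⊆σ = chain , T-last
  where
  open Shuffle n a 1≤a π θ σ |π|≡a π-unique θ-letters |σ|≡n π⊆σ θ⊆σ
  chain : (i : ℕ) → 1 ≤ i → i < a → TI a θ π σ i Sub.⊆ TI a θ π σ (suc i)
  chain (suc i′) _ i<a = T-step i′ i<a
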